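{- Let $q>0$, $q\neq 1$, let $m$ be a positive integer and $r$ a nonnegative integer. Then for all nonnegative integers $n\ge k$, $$W_{m,r}[n,k]_q=q^{m\binom{k}{2}+kr}\sum_{0\le j_1\le j_2\le\cdots\le j_{n-k}\le k}\ \prod_{i=1}^{n-k}[mj_i+r]_q,$$ where the sum runs over integer sequences $j_1\le\cdots\le j_{n-k}$ with values in $\{0,1,\dots,k\}$ (for $n=k$ the sum consists of the empty sequence, contributing $1$).
   Context: For a real number $x$, $[x]_q=\frac{1-q^x}{1-q}$. The numbers $W_{m,r}[n,k]_q$ are defined for integers $n,k$ by $W_{m,r}[0,0]_q=1$, $W_{m,r}[n,k]_q=0$ if $n<k$ or $n<0$ or $k<0$, and for $n\ge 1$ by $$W_{m,r}[n,k]_q=q^{m(k-1)+r}W_{m,r}[n-1,k-1]_q+[mk+r]_q\,W_{m,r}[n-1,k]_q.$$ -}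

module Defs where

open import Level using (Level)
open import Algebra.Bundles using (CommutativeRing)
open import Data.Nat as ℕ using (ℕ; zero; suc)
open import Data.Nat.Properties using (≤-totalOrder; _≤?_)
open import Data.Nat.Combinatorics using (_C_)
open import Data.List using (List; []; _∷_; [_]; map; concatMap; upTo; filter; foldr)
open import Data.List.Relation.Unary.Sorted.TotalOrder ≤-totalOrder using (Sorted; sorted?)

allSeqs : ℕ → ℕ → List (List ℕ)
allSeqs zero    k = [ [] ]
allSeqs (suc L) k = concatMap (λ j → map (j ∷_) (allSeqs L k)) (upTo (suc k))

incSeqs : ℕ → ℕ → List (List ℕ)
incSeqs L k = filter (sorted? _≤?_) (allSeqs L k)

-- Everything below lives in a commutative ring R with a parameter q and
-- an element u that is an inverse of (1 - q) (i.e. u = 1/(1-q), needs q ≠ 1).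
module QDefs {c ℓ : Level} (R : CommutativeRing c ℓ) where
  open CommutativeRing R hiding (zero)

  pow : Carrier → ℕ → Carrier
  pow x zero    = 1#
  pow x (suc n) = x * pow x n

  sumR : List Carrier → Carrier
  sumR = foldr _+_ 0#

  prodR : List Carrier → Carrier
  prodR = foldr _*_ 1#

  module _ (q u : Carrier) where
    -- [x]_q = (1 - q^x) / (1 - q), with u playing the role of 1/(1-q)
    qint : ℕ → Carrier
    qint x = (1# - pow q x) * u

    -- W_{m,r}[n,k]_q for n,k ≥ 0 (values at negative indices are 0).
    W : (m r : ℕ) → ℕ → ℕ → Carrier
    W m r zero    zero    = 1#
    W m r zero    (suc k) = 0#
    W m r (suc n) zero    = qint r * W m r n zero
    W m r (suc n) (suc k) =
      pow q (m ℕ.* k ℕ.+ r) * W m r n k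
      + qint (m ℕ.* suc k ℕ.+ r) * W m r n (suc k)

    RHS : (m r n k : ℕ) → Carrier
    RHS m r n k =
      pow q (m ℕ.* (k C 2) ℕ.+ k ℕ.* r)
      * sumR (map (λ js → prodR (map (λ j → qint (m ℕ.* j ℕ.+ r)) js))
                  (incSeqs (n ℕ.∸ k) k))

-- Put aⱼ = [mj + r]_q and let h_L(a_lo, …, a_k) be the complete homogeneous
-- symmetric polynomial, the sum over weakly increasing lo ≤ j₁ ≤ … ≤ j_L ≤ k of
-- a_{j₁} ⋯ a_{j_L}.  The claim is W[k + L, k] = q^{m C(k,2) + k r} h_L(a₀, …, a_k).
-- Splitting the sequences by whether they reach k + 1 gives
--   h_L(a₀, …, a_{k+1}) = h_L(a₀, …, a_k) + a_{k+1} h_{L-1}(a₀, …, a_{k+1}),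
-- and together with q^{m C(k+1,2) + (k+1) r} = q^{mk+r} q^{m C(k,2) + k r} this is
-- exactly the recurrence defining W.  The recurrence for h is proved by expanding
-- along the first entry, h_L(a_lo, …, a_k) = Σ_{lo ≤ j ≤ k} aⱼ h_{L-1}(aⱼ, …, a_k),
-- and inducting on L.
module Submission where

open import Defs
open import Level using (Level)
open import Algebra.Bundles using (CommutativeRing)
open import Data.Bool.Base using (if_then_else_)
open import Data.Nat as Nat using (ℕ; zero; suc; _∸_; _≤_; _<_; z≤n; s≤s)
open import Data.Nat.Properties as NatP
  using (≤-totalOrder; _≤?_; ≤-refl; <⇒≱; <⇒≤; m<n⇒m<1+n; n<1+n; m+[n∸m]≡n)
open import Data.Nat.Combinatorics using (_C_; nCk+nC[k+1]≡[n+1]C[k+1]; nC1≡n)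
open import Data.Nat.Tactic.RingSolver using (solve-∀)
open import Data.List using (List; []; _∷_; [_]; _++_; map; concatMap; upTo; filter)
open import Data.List.Properties using (map-++; map-∘; upTo-∷ʳ)
open import Data.List.Relation.Unary.Linked as Linked using ([]; [-]; _∷_)
open import Data.List.Relation.Unary.Sorted.TotalOrder ≤-totalOrder using (Sorted; sorted?)
open import Data.Product using (_,_)
open import Data.Empty using (⊥-elim)
open import Function.Base using (_∘′_)
open import Relation.Nullary using (Dec; does; yes; no; ¬_; _×-dec_)
open import Relation.Unary using (Pred; Decidable)
open import Relation.Binary.PropositionalEquality as ≡ using (_≡_)
import Algebra.Properties.CommutativeSemigroup as CommSemigroupProperties

module _ where
  open Nat using (_+_; _*_)

  sucC2 : ∀ k → suc k C 2 ≡ k + k C 2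
  sucC2 k = ≡.trans (≡.sym (nCk+nC[k+1]≡[n+1]C[k+1] k 1)) (≡.cong (_+ k C 2) (nC1≡n k))

  exponent-suc : ∀ m r k → m * (suc k C 2) + suc k * r ≡ (m * k + r) + (m * (k C 2) + k * r)
  exponent-suc m r k = ≡.trans (≡.cong (λ c → m * c + suc k * r) (sucC2 k)) (distribute m k (k C 2) r)
    where
    distribute : ∀ m k c r → m * (k + c) + (r + k * r) ≡ (m * k + r) + (m * c + k * r)
    distribute = solve-∀

Sorted-0∷ : ∀ {js} → Sorted js → Sorted (0 ∷ js)
Sorted-0∷ {[]}    _ = [-]
Sorted-0∷ {_ ∷ _} s = z≤n ∷ s

module _ {c ℓ : Level} (R : CommutativeRing c ℓ) where
  open CommutativeRing R hiding (zero)
  open QDefs R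
  open CommSemigroupProperties *-commutativeSemigroup using (x∙yz≈y∙xz)
  open CommSemigroupProperties +-commutativeSemigroup using (interchange)
  open import Relation.Binary.Reasoning.Setoid setoid

  𝟙 : {a : Level} {A : Set a} → Dec A → Carrier
  𝟙 d = if does d then 1# else 0#

  module _ {a : Level} {A : Set a} where

    𝟙-yes : (d : Dec A) → A → 𝟙 d ≈ 1#
    𝟙-yes (yes _) _ = refl
    𝟙-yes (no ¬x) x = ⊥-elim (¬x x)

    𝟙-no : (d : Dec A) → ¬ A → 𝟙 d ≈ 0#
    𝟙-no (yes x) ¬x = ⊥-elim (¬x x)
    𝟙-no (no _)  _  = refl

    𝟙-yes-* : (d : Dec A) → A → ∀ x → 𝟙 d * x ≈ x
    𝟙-yes-* d p x = trans (*-congʳ (𝟙-yes d p)) (*-identityˡ x)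

    𝟙-no-* : (d : Dec A) → ¬ A → ∀ x → 𝟙 d * x ≈ 0#
    𝟙-no-* d ¬p x = trans (*-congʳ (𝟙-no d ¬p)) (zeroˡ x)

    𝟙-cong : {b : Level} {B : Set b} → (A → B) → (B → A) → (d : Dec A) (e : Dec B) → 𝟙 d ≈ 𝟙 e
    𝟙-cong to from d (yes y) = 𝟙-yes d (from y)
    𝟙-cong to from d (no ¬y) = 𝟙-no d (λ x → ¬y (to x))

    𝟙-× : {b : Level} {B : Set b} (d : Dec A) (e : Dec B) → 𝟙 (d ×-dec e) ≈ 𝟙 d * 𝟙 e
    𝟙-× (yes _) (yes _) = sym (*-identityˡ 1#)
    𝟙-× (yes _) (no _)  = sym (*-identityˡ 0#)
    𝟙-× (no _)  _       = sym (zeroˡ _)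

  sumR-++ : ∀ xs ys → sumR (xs ++ ys) ≈ sumR xs + sumR ys
  sumR-++ []       ys = sym (+-identityˡ _)
  sumR-++ (x ∷ xs) ys = trans (+-congˡ (sumR-++ xs ys)) (sym (+-assoc _ _ _))

  module _ {a : Level} {A : Set a} where

    sumR-map-cong : {g h : A → Carrier} → (∀ x → g x ≈ h x) → ∀ xs → sumR (map g xs) ≈ sumR (map h xs)
    sumR-map-cong g≈h []       = refl
    sumR-map-cong g≈h (x ∷ xs) = +-cong (g≈h x) (sumR-map-cong g≈h xs)

    *-distribˡ-sumR : ∀ z (h : A → Carrier) xs → z * sumR (map h xs) ≈ sumR (map (λ x → z * h x) xs)
    *-distribˡ-sumR z h []       = zeroʳ z
    *-distribˡ-sumR z h (x ∷ xs) = trans (distribˡ z _ _) (+-congˡ (*-distribˡ-sumR z h xs))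

    sumR-filter : {p : Level} {P : Pred A p} (P? : Decidable P) (h : A → Carrier) → ∀ xs →
                  sumR (map h (filter P? xs)) ≈ sumR (map (λ x → 𝟙 (P? x) * h x) xs)
    sumR-filter P? h [] = refl
    sumR-filter P? h (x ∷ xs) with P? x
    ... | yes _ = +-cong (sym (*-identityˡ _)) (sumR-filter P? h xs)
    ... | no  _ = trans (sumR-filter P? h xs) (sym (trans (+-congʳ (zeroˡ _)) (+-identityˡ _)))

    sumR-concatMap : {b : Level} {B : Set b} (g : A → List B) (h : B → Carrier) → ∀ xs →
                     sumR (map h (concatMap g xs)) ≈ sumR (map (λ x → sumR (map h (g x))) xs)
    sumR-concatMap g h []       = refl
    sumR-concatMap g h (x ∷ xs) = begin
      sumR (map h (g x ++ concatMap g xs))            ≡⟨ ≡.cong sumR (map-++ h (g x) _) ⟩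
      sumR (map h (g x) ++ map h (concatMap g xs))    ≈⟨ sumR-++ (map h (g x)) _ ⟩
      sumR (map h (g x)) + sumR (map h (concatMap g xs)) ≈⟨ +-congˡ (sumR-concatMap g h xs) ⟩
      sumR (map (λ x → sumR (map h (g x))) (x ∷ xs))  ∎

  sumBelow : ℕ → (ℕ → Carrier) → Carrier
  sumBelow zero    g = 0#
  sumBelow (suc n) g = sumBelow n g + g n

  sumR-upTo : ∀ (g : ℕ → Carrier) n → sumR (map g (upTo n)) ≈ sumBelow n g
  sumR-upTo g zero    = refl
  sumR-upTo g (suc n) = begin
    sumR (map g (upTo (suc n)))          ≡⟨ ≡.cong (sumR ∘′ map g) (≡.sym (upTo-∷ʳ n)) ⟩
    sumR (map g (upTo n ++ [ n ]))       ≡⟨ ≡.cong sumR (map-++ g (upTo n) [ n ]) ⟩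
    sumR (map g (upTo n) ++ [ g n ])     ≈⟨ sumR-++ (map g (upTo n)) [ g n ] ⟩
    sumR (map g (upTo n)) + (g n + 0#)   ≈⟨ +-cong (sumR-upTo g n) (+-identityʳ (g n)) ⟩
    sumBelow n g + g n                   ∎

  sumBelow-cong : ∀ n {g h : ℕ → Carrier} → (∀ j → j < n → g j ≈ h j) → sumBelow n g ≈ sumBelow n h
  sumBelow-cong zero    g≈h = refl
  sumBelow-cong (suc n) g≈h = +-cong (sumBelow-cong n (λ j j<n → g≈h j (m<n⇒m<1+n j<n))) (g≈h n (n<1+n n))

  sumBelow-vanish : ∀ n {g : ℕ → Carrier} → (∀ j → j < n → g j ≈ 0#) → sumBelow n g ≈ 0#
  sumBelow-vanish zero    g≈0 = refl
  sumBelow-vanish (suc n) g≈0 =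
    trans (+-cong (sumBelow-vanish n (λ j j<n → g≈0 j (m<n⇒m<1+n j<n))) (g≈0 n (n<1+n n))) (+-identityʳ 0#)

  sumBelow-+ : ∀ n (g h : ℕ → Carrier) → sumBelow n (λ j → g j + h j) ≈ sumBelow n g + sumBelow n h
  sumBelow-+ zero    g h = sym (+-identityʳ 0#)
  sumBelow-+ (suc n) g h = trans (+-congʳ (sumBelow-+ n g h)) (interchange _ _ _ _)

  *-distribˡ-sumBelow : ∀ z n (g : ℕ → Carrier) → z * sumBelow n g ≈ sumBelow n (λ j → z * g j)
  *-distribˡ-sumBelow z zero    g = zeroʳ z
  *-distribˡ-sumBelow z (suc n) g = trans (distribˡ z _ _) (+-congʳ (*-distribˡ-sumBelow z n g))

  𝟙-sorted-∷ : ∀ lo j js →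
    𝟙 (sorted? _≤?_ (lo ∷ j ∷ js)) ≈ 𝟙 (lo ≤? j) * 𝟙 (sorted? _≤?_ (j ∷ js))
  𝟙-sorted-∷ lo j js = trans
    (𝟙-cong (λ s → Linked.head s , Linked.tail s) (λ (lo≤j , s) → lo≤j ∷ s)
            (sorted? _≤?_ (lo ∷ j ∷ js)) (lo ≤? j ×-dec sorted? _≤?_ (j ∷ js)))
    (𝟙-× (lo ≤? j) (sorted? _≤?_ (j ∷ js)))

  module _ (a : ℕ → Carrier) where

    weight : List ℕ → Carrier
    weight js = prodR (map a js)

    weightFrom : ℕ → List ℕ → Carrier
    weightFrom lo js = 𝟙 (sorted? _≤?_ (lo ∷ js)) * weight js

    -- complete L lo k is the complete homogeneous symmetric polynomial h_L(a_lo, …, a_k).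
    complete : (L lo k : ℕ) → Carrier
    complete L lo k = sumR (map (weightFrom lo) (allSeqs L k))

    complete-zero : ∀ lo k → complete 0 lo k ≈ 1#
    complete-zero lo k = trans (+-identityʳ _) (𝟙-yes-* (sorted? _≤?_ [ lo ]) [-] 1#)

    weightFrom-∷ : ∀ lo j js → weightFrom lo (j ∷ js) ≈ 𝟙 (lo ≤? j) * (a j * weightFrom j js)
    weightFrom-∷ lo j js = begin
      𝟙 (sorted? _≤?_ (lo ∷ j ∷ js)) * (a j * weight js)
        ≈⟨ *-congʳ (𝟙-sorted-∷ lo j js) ⟩
      (𝟙 (lo ≤? j) * 𝟙 (sorted? _≤?_ (j ∷ js))) * (a j * weight js)
        ≈⟨ *-assoc _ _ _ ⟩
      𝟙 (lo ≤? j) * (𝟙 (sorted? _≤?_ (j ∷ js)) * (a j * weight js))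
        ≈⟨ *-congˡ (x∙yz≈y∙xz _ (a j) (weight js)) ⟩
      𝟙 (lo ≤? j) * (a j * weightFrom j js) ∎

    complete-suc : ∀ L lo k →
      complete (suc L) lo k ≈ sumBelow (suc k) (λ j → 𝟙 (lo ≤? j) * (a j * complete L j k))
    complete-suc L lo k = begin
      complete (suc L) lo k
        ≈⟨ sumR-concatMap (λ j → map (j ∷_) (allSeqs L k)) (weightFrom lo) (upTo (suc k)) ⟩
      sumR (map (λ j → sumR (map (weightFrom lo) (map (j ∷_) (allSeqs L k)))) (upTo (suc k)))
        ≈⟨ sumR-map-cong expand (upTo (suc k)) ⟩
      sumR (map (λ j → 𝟙 (lo ≤? j) * (a j * complete L j k)) (upTo (suc k)))
        ≈⟨ sumR-upTo _ (suc k) ⟩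
      sumBelow (suc k) (λ j → 𝟙 (lo ≤? j) * (a j * complete L j k)) ∎
      where
      expand : ∀ j → sumR (map (weightFrom lo) (map (j ∷_) (allSeqs L k)))
                   ≈ 𝟙 (lo ≤? j) * (a j * complete L j k)
      expand j = begin
        sumR (map (weightFrom lo) (map (j ∷_) (allSeqs L k)))
          ≡⟨ ≡.cong sumR (≡.sym (map-∘ (allSeqs L k))) ⟩
        sumR (map (λ js → weightFrom lo (j ∷ js)) (allSeqs L k))
          ≈⟨ sumR-map-cong (weightFrom-∷ lo j) (allSeqs L k) ⟩
        sumR (map (λ js → 𝟙 (lo ≤? j) * (a j * weightFrom j js)) (allSeqs L k))
          ≈⟨ *-distribˡ-sumR (𝟙 (lo ≤? j)) (λ js → a j * weightFrom j js) (allSeqs L k) ⟨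
        𝟙 (lo ≤? j) * sumR (map (λ js → a j * weightFrom j js) (allSeqs L k))
          ≈⟨ *-congˡ (*-distribˡ-sumR (a j) (weightFrom j) (allSeqs L k)) ⟨
        𝟙 (lo ≤? j) * (a j * complete L j k) ∎

    complete-diag : ∀ L k → complete (suc L) k k ≈ a k * complete L k k
    complete-diag L k = begin
      complete (suc L) k k
        ≈⟨ complete-suc L k k ⟩
      sumBelow k (λ j → 𝟙 (k ≤? j) * (a j * complete L j k)) + 𝟙 (k ≤? k) * (a k * complete L k k)
        ≈⟨ +-cong (sumBelow-vanish k (λ j j<k → 𝟙-no-* (k ≤? j) (<⇒≱ j<k) _))
                  (𝟙-yes-* (k ≤? k) ≤-refl _) ⟩
      0# + a k * complete L k k
        ≈⟨ +-identityˡ _ ⟩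
      a k * complete L k k ∎

    complete-split-top : ∀ L lo k → lo ≤ suc k →
      complete (suc L) lo (suc k) ≈
        sumBelow (suc k) (λ j → 𝟙 (lo ≤? j) * (a j * complete L j (suc k))) + a (suc k) * complete L (suc k) (suc k)
    complete-split-top L lo k lo≤ =
      trans (complete-suc L lo (suc k)) (+-congˡ (𝟙-yes-* (lo ≤? suc k) lo≤ _))

    complete-top : ∀ L lo k → lo ≤ suc k →
      complete (suc L) lo (suc k) ≈ complete (suc L) lo k + a (suc k) * complete L lo (suc k)
    complete-top zero lo k lo≤ = begin
      complete 1 lo (suc k)
        ≈⟨ complete-split-top 0 lo k lo≤ ⟩
      sumBelow (suc k) (λ j → 𝟙 (lo ≤? j) * (a j * complete 0 j (suc k))) + a (suc k) * complete 0 (suc k) (suc k)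
        ≈⟨ +-cong (sumBelow-cong (suc k) (λ j _ → *-congˡ (*-congˡ (complete-zero-indep j (suc k) j k))))
                  (*-congˡ (complete-zero-indep (suc k) (suc k) lo (suc k))) ⟩
      sumBelow (suc k) (λ j → 𝟙 (lo ≤? j) * (a j * complete 0 j k)) + a (suc k) * complete 0 lo (suc k)
        ≈⟨ +-congʳ (complete-suc 0 lo k) ⟨
      complete 1 lo k + a (suc k) * complete 0 lo (suc k) ∎
      where
      complete-zero-indep : ∀ lo k lo′ k′ → complete 0 lo k ≈ complete 0 lo′ k′
      complete-zero-indep lo k lo′ k′ = trans (complete-zero lo k) (sym (complete-zero lo′ k′))
    complete-top (suc L) lo k lo≤ = begin
      complete (suc (suc L)) lo (suc k)
        ≈⟨ complete-split-top (suc L) lo k lo≤ ⟩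
      sumBelow (suc k) (term (suc L) (suc k)) + a′ * complete (suc L) (suc k) (suc k)
        ≈⟨ +-cong (sumBelow-cong (suc k) λ j j<1+k →
                     trans (*-congˡ (*-congˡ (complete-top L j k (<⇒≤ j<1+k)))) (distribute _ (a j) _ _))
                  (*-congˡ (complete-diag L (suc k))) ⟩
      sumBelow (suc k) (λ j → term (suc L) k j + a′ * term L (suc k) j) + a′ * (a′ * complete L (suc k) (suc k))
        ≈⟨ +-congʳ (trans (sumBelow-+ (suc k) _ _) (+-congˡ (sym (*-distribˡ-sumBelow a′ (suc k) _)))) ⟩
      (sumBelow (suc k) (term (suc L) k) + a′ * sumBelow (suc k) (term L (suc k)))
        + a′ * (a′ * complete L (suc k) (suc k))
        ≈⟨ trans (+-assoc _ _ _) (+-congˡ (sym (distribˡ a′ _ _))) ⟩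
      sumBelow (suc k) (term (suc L) k)
        + a′ * (sumBelow (suc k) (term L (suc k)) + a′ * complete L (suc k) (suc k))
        ≈⟨ +-cong (complete-suc (suc L) lo k) (*-congˡ (complete-split-top L lo k lo≤)) ⟨
      complete (suc (suc L)) lo k + a′ * complete (suc L) lo (suc k) ∎
      where
      a′ : Carrier
      a′ = a (suc k)
      term : ℕ → ℕ → ℕ → Carrier
      term L k j = 𝟙 (lo ≤? j) * (a j * complete L j k)
      distribute : ∀ x y z w → x * (y * (z + a′ * w)) ≈ x * (y * z) + a′ * (x * (y * w))
      distribute x y z w = begin
        x * (y * (z + a′ * w))            ≈⟨ trans (*-congˡ (distribˡ y z _)) (distribˡ x _ _) ⟩
        x * (y * z) + x * (y * (a′ * w))  ≈⟨ +-congˡ (*-congˡ (x∙yz≈y∙xz y a′ w)) ⟩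
        x * (y * z) + x * (a′ * (y * w))  ≈⟨ +-congˡ (x∙yz≈y∙xz x a′ _) ⟩
        x * (y * z) + a′ * (x * (y * w))  ∎

    sumR-incSeqs : ∀ L k → sumR (map weight (incSeqs L k)) ≈ complete L 0 k
    sumR-incSeqs L k = trans (sumR-filter (sorted? _≤?_) weight (allSeqs L k)) (sumR-map-cong from0 (allSeqs L k))
      where
      from0 : ∀ js → 𝟙 (sorted? _≤?_ js) * weight js ≈ weightFrom 0 js
      from0 js = *-congʳ (𝟙-cong Sorted-0∷ Linked.tail (sorted? _≤?_ js) (sorted? _≤?_ (0 ∷ js)))

  pow-+ : ∀ x i j → pow x (i Nat.+ j) ≈ pow x i * pow x j
  pow-+ x zero    j = sym (*-identityˡ _)
  pow-+ x (suc i) j = trans (*-congˡ (pow-+ x i j)) (sym (*-assoc _ _ _))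

  module _ (q u : Carrier) (m r : ℕ) where

    qbracket : ℕ → Carrier
    qbracket j = qint q u (m Nat.* j Nat.+ r)

    prefactor : ℕ → Carrier
    prefactor k = pow q (m Nat.* (k C 2) Nat.+ k Nat.* r)

    prefactor-zero : prefactor 0 ≈ 1#
    prefactor-zero = reflexive (≡.cong (pow q) (≡.trans (NatP.+-identityʳ _) (NatP.*-zeroʳ m)))

    prefactor-absorb : ∀ k {x y} → x ≈ prefactor k * y → pow q (m Nat.* k Nat.+ r) * x ≈ prefactor (suc k) * y
    prefactor-absorb k {x} {y} x≈ = begin
      pow q (m Nat.* k Nat.+ r) * x                 ≈⟨ trans (*-congˡ x≈) (sym (*-assoc _ _ _)) ⟩
      (pow q (m Nat.* k Nat.+ r) * prefactor k) * y ≈⟨ *-congʳ (pow-+ q (m Nat.* k Nat.+ r) _) ⟨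
      pow q ((m Nat.* k Nat.+ r) Nat.+ (m Nat.* (k C 2) Nat.+ k Nat.* r)) * y
        ≡⟨ ≡.cong (λ e → pow q e * y) (≡.sym (exponent-suc m r k)) ⟩
      prefactor (suc k) * y ∎

    W-vanishes : ∀ {n k} → n < k → W q u m r n k ≈ 0#
    W-vanishes {zero}  {suc k} _         = refl
    W-vanishes {suc n} {suc k} (s≤s n<k) = begin
      pow q (m Nat.* k Nat.+ r) * W q u m r n k + qbracket (suc k) * W q u m r n (suc k)
        ≈⟨ +-cong (*-congˡ (W-vanishes n<k)) (*-congˡ (W-vanishes (m<n⇒m<1+n n<k))) ⟩
      pow q (m Nat.* k Nat.+ r) * 0# + qbracket (suc k) * 0#
        ≈⟨ trans (+-cong (zeroʳ _) (zeroʳ _)) (+-identityʳ 0#) ⟩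
      0# ∎

    W-closed-form : ∀ k d → W q u m r (k Nat.+ d) k ≈ prefactor k * complete qbracket d 0 k
    W-closed-form zero zero = sym (trans (*-cong prefactor-zero (complete-zero qbracket 0 0)) (*-identityˡ 1#))
    W-closed-form zero (suc d) = begin
      qint q u r * W q u m r d 0
        ≈⟨ *-cong (reflexive (≡.cong (λ z → qint q u (z Nat.+ r)) (≡.sym (NatP.*-zeroʳ m))))
                  (W-closed-form zero d) ⟩
      qbracket 0 * (prefactor 0 * complete qbracket d 0 0)
        ≈⟨ x∙yz≈y∙xz _ _ _ ⟩
      prefactor 0 * (qbracket 0 * complete qbracket d 0 0)
        ≈⟨ *-congˡ (complete-diag qbracket d 0) ⟨
      prefactor 0 * complete qbracket (suc d) 0 0 ∎
    W-closed-form (suc k) zero = begin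
      pow q (m Nat.* k Nat.+ r) * W q u m r (k Nat.+ 0) k + qbracket (suc k) * W q u m r (k Nat.+ 0) (suc k)
        ≈⟨ +-cong (prefactor-absorb k (W-closed-form k 0))
                  (*-congˡ (W-vanishes (s≤s (NatP.≤-reflexive (NatP.+-identityʳ k))))) ⟩
      prefactor (suc k) * complete qbracket 0 0 k + qbracket (suc k) * 0#
        ≈⟨ trans (+-congˡ (zeroʳ _)) (+-identityʳ _) ⟩
      prefactor (suc k) * complete qbracket 0 0 k
        ≈⟨ *-congˡ (trans (complete-zero qbracket 0 k) (sym (complete-zero qbracket 0 (suc k)))) ⟩
      prefactor (suc k) * complete qbracket 0 0 (suc k) ∎
    W-closed-form (suc k) (suc d) = begin
      pow q (m Nat.* k Nat.+ r) * W q u m r (k Nat.+ suc d) k + qbracket (suc k) * W q u m r (k Nat.+ suc d) (suc k)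
        ≈⟨ +-cong (prefactor-absorb k (W-closed-form k (suc d)))
                  (*-congˡ (trans (reflexive (≡.cong (λ n → W q u m r n (suc k)) (NatP.+-suc k d)))
                                  (W-closed-form (suc k) d))) ⟩
      prefactor (suc k) * complete qbracket (suc d) 0 k
        + qbracket (suc k) * (prefactor (suc k) * complete qbracket d 0 (suc k))
        ≈⟨ trans (+-congˡ (x∙yz≈y∙xz _ _ _)) (sym (distribˡ _ _ _)) ⟩
      prefactor (suc k) * (complete qbracket (suc d) 0 k + qbracket (suc k) * complete qbracket d 0 (suc k))
        ≈⟨ *-congˡ (complete-top qbracket d 0 k z≤n) ⟨
      prefactor (suc k) * complete qbracket (suc d) 0 (suc k) ∎

mainTheorem6 : {c ℓ : Level} (R : CommutativeRing c ℓ) →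
    let open CommutativeRing R in
    (q u : Carrier) → (1# - q) * u ≈ 1# →
    (m r : ℕ) → 1 ≤ m → (n k : ℕ) → k ≤ n →
    QDefs.W R q u m r n k ≈ QDefs.RHS R q u m r n k
mainTheorem6 R q u _ m r _ n k k≤n = begin
  W n k                                      ≡⟨ ≡.cong (λ n → W n k) (≡.sym (m+[n∸m]≡n k≤n)) ⟩
  W (k Nat.+ (n ∸ k)) k                      ≈⟨ W-closed-form R q u m r k (n ∸ k) ⟩
  prefactor R q u m r k * complete R (qbracket R q u m r) (n ∸ k) 0 k
                                             ≈⟨ *-congˡ (sumR-incSeqs R (qbracket R q u m r) (n ∸ k) k) ⟨
  QDefs.RHS R q u m r n k                    ∎
  where
  open CommutativeRing R
  open import Relation.Binary.Reasoning.Setoid setoid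
  W : ℕ → ℕ → Carrier
  W = QDefs.W R q u m r
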